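{- The function $\mathsf{E}\colon\mathbb{Z}^2\to\mathbb{Z}$ does not belong to $\{\max,\mathsf{div}_m\mid m\in\mathbb{Z}\setminus\{0\}\}^\circ$.
   Context: $\mathsf{E}(x,y)=y$ if $x=0$ and $0$ otherwise; $\mathsf{div}_m(x)=\lfloor x/m\rfloor$. For a set $F$ of functions, $F^\circ$ is the set of all functions computed by circuits whose gates compute either affine functions with integer coefficients of their inputs or functions from $F$. -}

module Defs where

open import Data.Nat using (ℕ; zero; suc; _+_)
open import Data.Integer using (ℤ; +_; -[1+_]; -_; _⊔_; _*_) renaming (_+_ to _+ℤ_)
open import Data.Integer.DivMod using (_/_)
open import Data.Fin using (Fin)
open import Data.Vec using (Vec; []; _∷_; lookup; zipWith; foldr; _∷ʳ_)
open import Data.Empty using (⊥-elim)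
open import Relation.Binary.PropositionalEquality using (_≡_; _≢_; refl)
import Data.Product

E : ℤ → ℤ → ℤ
E (+ zero)  y = y
E (+ suc _) y = + 0
E -[1+ _ ]  y = + 0

-- div_m(x) = ⌊ x / m ⌋ (floor division, m ≠ 0).
-- Stdlib's _/_ is Euclidean (remainder ≥ 0), which equals floor for positive
-- divisors; for negative m we use ⌊x/m⌋ = ⌊(-x)/(-m)⌋.
divFloor : (m : ℤ) → m ≢ + 0 → ℤ → ℤ
divFloor (+ zero)  m≢0 x = ⊥-elim (m≢0 refl)
divFloor (+ suc k) _   x = x / (+ suc k)
divFloor -[1+ k ]  _   x = (- x) / (+ suc k)

dot : ∀ {w} → Vec ℤ w → Vec ℤ w → ℤ
dot c v = foldr _ _+ℤ_ (+ 0) (zipWith _*_ c v)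

data Gate (w : ℕ) : Set where
  affine : (c : ℤ) → (coeffs : Vec ℤ w) → Gate w
  maxG   : Fin w → Fin w → Gate w
  divG   : (m : ℤ) → m ≢ + 0 → Fin w → Gate w

evalGate : ∀ {w} → Gate w → Vec ℤ w → ℤ
evalGate (affine c coeffs) v = c +ℤ dot coeffs v
evalGate (maxG i j)        v = lookup v i ⊔ lookup v j
evalGate (divG m m≢0 i)    v = divFloor m m≢0 (lookup v i)

-- A circuit with n inputs and k gates, given as a straight-line program
-- (gates in topological order; gate number j reads the n inputs and the
-- outputs of gates 0..j-1).
data Gates (n : ℕ) : ℕ → Set where
  []  : Gates n zero
  _▷_ : ∀ {k} → Gates n k → Gate (k + n) → Gates n (suc k)

-- values on all wires: gate outputs (most recent first) followed by the inputs
wires : ∀ {n k} → Gates n k → Vec ℤ n → Vec ℤ (k + n)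
wires []       x = x
wires (gs ▷ g) x = let v = wires gs x in evalGate g v ∷ v

record Circuit (n : ℕ) : Set where
  constructor circuit
  field
    size   : ℕ
    gates  : Gates n size
    output : Fin (size + n)

eval : ∀ {n} → Circuit n → Vec ℤ n → ℤ
eval (circuit _ gs o) x = lookup (wires gs x) o

InMaxDivClosure₂ : (ℤ → ℤ → ℤ) → Set
InMaxDivClosure₂ f = Data.Product.Σ (Circuit 2) λ C → ∀ x y → eval C (x ∷ y ∷ []) ≡ f x y

{-# OPTIONS --safe #-}
-- Every circuit built from affine gates, max and div_m is Lipschitz for the
-- sup-distance on ℤⁿ: if all inputs move by at most B, an affine gate moves by
-- at most (Σ ∣cᵢ∣) B, while max and ⌊·/m⌋ move by at most B.  But E is not
-- Lipschitz: E(0, y) − E(1, y) = y is unbounded although the inputs differ by 1.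
module Submission where

open import Defs
open import Relation.Nullary using (¬_)

open import Data.Nat as ℕ using (ℕ; suc)
import Data.Nat.Properties as ℕ
open import Data.Integer as ℤ
  using (ℤ; +_; -[1+_]; -_; _⊔_; _*_; _-_; ∣_∣; _≤_; _<_; +≤+; -≤+; +<+)
  renaming (_+_ to _+ℤ_)
open import Data.Integer.Properties
open import Data.Integer.DivMod using (_/_; _%_; a≡a%n+[a/n]*n; n%d<d; [n/d]*d≤n)
open import Data.Integer.Tactic.RingSolver using (solve-∀)
open import Data.Vec using (Vec; []; _∷_; map; sum)
open import Data.Vec.Relation.Binary.Pointwise.Inductive as Pointwise using (Pointwise; []; _∷_)
open import Data.Product using (_,_; ∃-syntax)
open import Data.Sum using (inj₁; inj₂)
open import Data.Empty using (⊥-elim)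
open import Relation.Binary.PropositionalEquality using (_≡_; _≢_; refl; sym; trans; cong; subst; subst₂)

-- A record rather than a synonym for ∣ a - b ∣ ≤ B, so that B, a and b are inferable.
record Near (B : ℕ) (a b : ℤ) : Set where
  constructor near
  field
    ∣-∣≤ : ∣ a - b ∣ ℕ.≤ B

open Near

near-refl : ∀ a → Near 0 a a
near-refl a = near (ℕ.≤-reflexive (cong ∣_∣ (+-inverseʳ a)))

near-sym : ∀ {B a b} → Near B a b → Near B b a
near-sym {B} {a} {b} (near d) = near (subst (ℕ._≤ B) (∣i-j∣≡∣j-i∣ a b) d)

near-weaken : ∀ {B B′ a b} → B ℕ.≤ B′ → Near B a b → Near B′ a b
near-weaken B≤B′ (near d) = near (ℕ.≤-trans d B≤B′)

near-+ : ∀ {B B′ a a′ b b′} → Near B a b → Near B′ a′ b′ → Near (B ℕ.+ B′) (a +ℤ a′) (b +ℤ b′)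
near-+ {a = a} {a′} {b} {b′} (near d) (near d′) = near (begin
  ∣ (a +ℤ a′) - (b +ℤ b′) ∣     ≡⟨ cong ∣_∣ (regroup a a′ b b′) ⟩
  ∣ (a - b) +ℤ (a′ - b′) ∣      ≤⟨ ∣i+j∣≤∣i∣+∣j∣ (a - b) (a′ - b′) ⟩
  ∣ a - b ∣ ℕ.+ ∣ a′ - b′ ∣     ≤⟨ ℕ.+-mono-≤ d d′ ⟩
  _                             ∎)
  where
  open ℕ.≤-Reasoning
  regroup : ∀ a a′ b b′ → (a +ℤ a′) - (b +ℤ b′) ≡ (a - b) +ℤ (a′ - b′)
  regroup = solve-∀

near-*ˡ : ∀ {B a b} c → Near B a b → Near (∣ c ∣ ℕ.* B) (c * a) (c * b)
near-*ˡ {a = a} {b} c (near d) = near (begin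
  ∣ c * a - c * b ∣     ≡⟨ cong ∣_∣ (factor c a b) ⟩
  ∣ c * (a - b) ∣       ≡⟨ ∣i*j∣≡∣i∣*∣j∣ c (a - b) ⟩
  ∣ c ∣ ℕ.* ∣ a - b ∣   ≤⟨ ℕ.*-monoʳ-≤ ∣ c ∣ d ⟩
  _                     ∎)
  where
  open ℕ.≤-Reasoning
  factor : ∀ c a b → c * a - c * b ≡ c * (a - b)
  factor = solve-∀

near-neg : ∀ {B a b} → Near B a b → Near B (- a) (- b)
near-neg {B} {a} {b} (near d) = near (subst (ℕ._≤ B) (sym ∣-a+b∣≡∣a-b∣) d)
  where
  negate : ∀ a b → - a - - b ≡ - (a - b)
  negate = solve-∀
  ∣-a+b∣≡∣a-b∣ : ∣ - a - - b ∣ ≡ ∣ a - b ∣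
  ∣-a+b∣≡∣a-b∣ = trans (cong ∣_∣ (negate a b)) (∣-i∣≡∣i∣ (a - b))

i≤+∣i∣ : ∀ i → i ≤ + ∣ i ∣
i≤+∣i∣ (+ n)    = ≤-refl
i≤+∣i∣ -[1+ n ] = -≤+

near⇒≤+ : ∀ {B a b} → Near B a b → a ≤ b +ℤ + B
near⇒≤+ {B} {a} {b} (near d) = begin
  a               ≡⟨ split a b ⟩
  (a - b) +ℤ b    ≤⟨ +-monoˡ-≤ b (≤-trans (i≤+∣i∣ (a - b)) (+≤+ d)) ⟩
  + B +ℤ b        ≡⟨ +-comm (+ B) b ⟩
  b +ℤ + B        ∎
  where
  open ≤-Reasoning
  split : ∀ a b → a ≡ (a - b) +ℤ b
  split = solve-∀

≤⇒≤+⇒near : ∀ {B a b} → a ≤ b → b ≤ a +ℤ + B → Near B a b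
≤⇒≤+⇒near {B} {a} {b} a≤b b≤a+B = near (drop‿+≤+ (begin
  + ∣ a - b ∣      ≡⟨ ∣-∣-≤ a≤b ⟩
  b - a            ≤⟨ +-monoˡ-≤ (- a) b≤a+B ⟩
  (a +ℤ + B) - a   ≡⟨ cancel a (+ B) ⟩
  + B              ∎))
  where
  open ≤-Reasoning
  cancel : ∀ a k → (a +ℤ k) - a ≡ k
  cancel = solve-∀

≤+⇒near : ∀ {B a b} → a ≤ b +ℤ + B → b ≤ a +ℤ + B → Near B a b
≤+⇒near {a = a} {b} a≤b+B b≤a+B with ≤-total a b
... | inj₁ a≤b = ≤⇒≤+⇒near a≤b b≤a+B
... | inj₂ b≤a = near-sym (≤⇒≤+⇒near b≤a a≤b+B)

⊔-≤+ : ∀ {B a a′ b b′} → a ≤ b +ℤ + B → a′ ≤ b′ +ℤ + B → a ⊔ a′ ≤ (b ⊔ b′) +ℤ + B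
⊔-≤+ {B} {b = b} {b′} a≤b+B a′≤b′+B =
  ⊔-lub (≤-trans a≤b+B (+-monoˡ-≤ (+ B) (i≤i⊔j b b′)))
        (≤-trans a′≤b′+B (+-monoˡ-≤ (+ B) (i≤j⊔i b b′)))

near-⊔ : ∀ {B a a′ b b′} → Near B a b → Near B a′ b′ → Near B (a ⊔ a′) (b ⊔ b′)
near-⊔ {B} {a} {a′} {b} {b′} a~b a′~b′ =
  ≤+⇒near (⊔-≤+ {B} {b = b} {b′} (near⇒≤+ a~b) (near⇒≤+ a′~b′))
          (⊔-≤+ {B} {b = a} {a′} (near⇒≤+ (near-sym a~b)) (near⇒≤+ (near-sym a′~b′)))

a<[1+a/d]*d : ∀ a d .{{_ : ℕ.NonZero d}} → a < ℤ.suc (a / + d) * + d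
a<[1+a/d]*d a d = begin-strict
  a                          ≡⟨ a≡a%n+[a/n]*n a (+ d) ⟩
  + (a % + d) +ℤ q * + d     <⟨ +-monoˡ-< (q * + d) (+<+ (n%d<d a (+ d))) ⟩
  + d +ℤ q * + d             ≡⟨ sym (suc-* q (+ d)) ⟩
  ℤ.suc q * + d              ∎
  where
  open ≤-Reasoning
  q : ℤ
  q = a / + d

/-≤+ : ∀ {B a b} d .{{_ : ℕ.NonZero d}} → a ≤ b +ℤ + B → a / + d ≤ b / + d +ℤ + B
/-≤+ {B} {a} {b} d a≤b+B =
  subst (a / + d ≤_) (pred-suc (q′ +ℤ + B)) (i<j⇒i≤pred[j] (*-cancelʳ-<-nonNeg {j = ℤ.suc (q′ +ℤ + B)} (+ d) qd<))
  where
  open ≤-Reasoning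
  q′ : ℤ
  q′ = b / + d
  B≤B*d : + B ≤ + B * + d
  B≤B*d = subst (+ B ≤_) (pos-* B d) (+≤+ (ℕ.m≤m*n B d))
  qd< : a / + d * + d < ℤ.suc (q′ +ℤ + B) * + d
  qd< = begin-strict
    a / + d * + d                   ≤⟨ [n/d]*d≤n a (+ d) ⟩
    a                               ≤⟨ a≤b+B ⟩
    b +ℤ + B                        <⟨ +-monoˡ-< (+ B) (a<[1+a/d]*d b d) ⟩
    ℤ.suc q′ * + d +ℤ + B           ≤⟨ +-monoʳ-≤ (ℤ.suc q′ * + d) B≤B*d ⟩
    ℤ.suc q′ * + d +ℤ + B * + d     ≡⟨ sym (*-distribʳ-+ (+ d) (ℤ.suc q′) (+ B)) ⟩
    (ℤ.suc q′ +ℤ + B) * + d         ≡⟨ cong (_* + d) (+-assoc (+ 1) q′ (+ B)) ⟩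
    ℤ.suc (q′ +ℤ + B) * + d         ∎

near-/ : ∀ {B a b} d .{{_ : ℕ.NonZero d}} → Near B a b → Near B (a / + d) (b / + d)
near-/ {B} {a} {b} d a~b =
  ≤+⇒near (/-≤+ {B} {a} {b} d (near⇒≤+ a~b)) (/-≤+ {B} {b} {a} d (near⇒≤+ (near-sym a~b)))

near-divFloor : ∀ {B a b} m (m≢0 : m ≢ + 0) → Near B a b → Near B (divFloor m m≢0 a) (divFloor m m≢0 b)
near-divFloor (+ 0)     m≢0 _   = ⊥-elim (m≢0 refl)
near-divFloor (+ suc k) _   a~b = near-/ (suc k) a~b
near-divFloor -[1+ k ]  _   a~b = near-/ (suc k) (near-neg a~b)

Lipschitz : ∀ {n} → ℕ → (Vec ℤ n → ℤ) → Set
Lipschitz {n} L f = ∀ {B} {u v : Vec ℤ n} → Pointwise (Near B) u v → Near (L ℕ.* B) (f u) (f v)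

‖_‖₁ : ∀ {w} → Vec ℤ w → ℕ
‖ cs ‖₁ = sum (map ∣_∣ cs)

dot-lipschitz : ∀ {w} (cs : Vec ℤ w) → Lipschitz ‖ cs ‖₁ (dot cs)
dot-lipschitz []       []              = near ℕ.z≤n
dot-lipschitz (c ∷ cs) {B} (x~y ∷ u~v) =
  near-weaken (ℕ.≤-reflexive (sym (ℕ.*-distribʳ-+ B ∣ c ∣ ‖ cs ‖₁)))
              (near-+ (near-*ˡ c x~y) (dot-lipschitz cs u~v))

gateConstant : ∀ {w} → Gate w → ℕ
gateConstant (affine _ cs) = ‖ cs ‖₁
gateConstant (maxG _ _)    = 1
gateConstant (divG _ _ _)  = 1

near-1* : ∀ {B a b} → Near B a b → Near (1 ℕ.* B) a b
near-1* {B} = near-weaken (ℕ.≤-reflexive (sym (ℕ.*-identityˡ B)))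

evalGate-lipschitz : ∀ {w} (g : Gate w) → Lipschitz (gateConstant g) (evalGate g)
evalGate-lipschitz (affine c cs)  u~v = near-+ (near-refl c) (dot-lipschitz cs u~v)
evalGate-lipschitz (maxG i j)     u~v = near-1* (near-⊔ (Pointwise.lookup u~v i) (Pointwise.lookup u~v j))
evalGate-lipschitz (divG m m≢0 i) u~v = near-1* (near-divFloor m m≢0 (Pointwise.lookup u~v i))

wiresConstant : ∀ {n k} → Gates n k → ℕ
wiresConstant []       = 1
wiresConstant (gs ▷ g) = suc (gateConstant g) ℕ.* wiresConstant gs

wires-lipschitz : ∀ {n k B} {u v : Vec ℤ n} (gs : Gates n k) →
                  Pointwise (Near B) u v → Pointwise (Near (wiresConstant gs ℕ.* B)) (wires gs u) (wires gs v)
wires-lipschitz []       u~v = Pointwise.map near-1* u~v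
wires-lipschitz {B = B} {u} {v} (gs ▷ g) u~v =
  near-weaken new≤ (evalGate-lipschitz g wires~) ∷ Pointwise.map (near-weaken old≤) wires~
  where
  L Lg : ℕ
  L  = wiresConstant gs
  Lg = gateConstant g
  wires~ : Pointwise (Near (L ℕ.* B)) (wires gs u) (wires gs v)
  wires~ = wires-lipschitz gs u~v
  old≤ : L ℕ.* B ℕ.≤ (L ℕ.+ Lg ℕ.* L) ℕ.* B
  old≤ = ℕ.*-monoˡ-≤ B (ℕ.m≤m+n L (Lg ℕ.* L))
  new≤ : Lg ℕ.* (L ℕ.* B) ℕ.≤ (L ℕ.+ Lg ℕ.* L) ℕ.* B
  new≤ = ℕ.≤-trans (ℕ.≤-reflexive (sym (ℕ.*-assoc Lg L B))) (ℕ.*-monoˡ-≤ B (ℕ.m≤n+m (Lg ℕ.* L) L))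

eval-lipschitz : ∀ {n} (C : Circuit n) → ∃[ L ] Lipschitz L (eval C)
eval-lipschitz (circuit _ gs o) = wiresConstant gs , λ u~v → Pointwise.lookup (wires-lipschitz gs u~v) o

E-jump-unbounded : ∀ L → ¬ (∀ y → Near L (E (+ 0) y) (E (+ 1) y))
E-jump-unbounded L jump = ℕ.m+n≮m L 0 (∣-∣≤ (jump (+ suc L)))

mainTheorem9 : ¬ InMaxDivClosure₂ E
mainTheorem9 (C , C≡E) with eval-lipschitz C
... | L , lipschitz = E-jump-unbounded (L ℕ.* 1) jump
  where
  inputs~ : ∀ y → Pointwise (Near 1) (+ 0 ∷ y ∷ []) (+ 1 ∷ y ∷ [])
  inputs~ y = near ℕ.≤-refl ∷ near-weaken ℕ.z≤n (near-refl y) ∷ []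
  jump : ∀ y → Near (L ℕ.* 1) (E (+ 0) y) (E (+ 1) y)
  jump y = subst₂ (Near (L ℕ.* 1)) (C≡E (+ 0) y) (C≡E (+ 1) y) (lipschitz (inputs~ y))
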